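{- Let $G$ be a finite group of order $2n$ with $n\geq 2$, and let $S$ be a generating set of $G$ (with $e\notin S$) such that the undirected Cayley graph $\Gamma(G,S)$ is a complete bipartite graph. Then Player 2 has a winning strategy for $\texttt{REL}(G,S)$ and Player 1 has a winning strategy for $\texttt{RAV}(G,S)$.
   Context: Games $\texttt{REL}(G,S)$ and $\texttt{RAV}(G,S)$: $G$ is a finite group and $S$ a generating set with $e\notin S$. Two players alternate turns, Player 1 first, starting from the empty word $w_0$. On turn $n$ the current player chooses $s_n\in S\cup S^{ -1}$, subject to $s_n\neq s_{n-1}^{ -1}$ when $n>1$, and forms $w_n=w_{n-1}s_n$. If $w_n$ represents the same element of $G$ as some $w_k$ with $0\le k<n$, the game ends: the player who formed $w_n$ wins $\texttt{REL}(G,S)$ and loses $\texttt{RAV}(G,S)$. If a player has no legal move, that player loses. The undirected Cayley graph $\Gamma(G,S)$ has vertex set $G$, with $g$ and $h$ adjacent whenever $h=gs$ for some $s\in S$; playing the games amounts to walking in $\Gamma(G,S)$ from $e$ without backtracking. -}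

module Defs where

open import Data.Bool using (Bool; true; false)
open import Data.List using (List; _∷_; [])
open import Data.List.Membership.Propositional using (_∈_)
open import Data.Maybe using (Maybe; just; nothing)
open import Data.Product using (Σ; ∃; _×_; _,_)
open import Data.Sum using (_⊎_)
open import Relation.Binary.PropositionalEquality using (_≡_; _≢_)
open import Relation.Nullary using (¬_)

-- Everything is parametrised by a carrier A, group operations and a subset S ⊆ A
-- (given as a predicate).  Group axioms are imposed in the theorem statement.
module Cayley {A : Set} (_∙_ : A → A → A) (ε : A) (_⁻¹ : A → A) (S : A → Set) where

  SymGen : A → Set
  SymGen s = S s ⊎ S (s ⁻¹)

  data Generated : A → Set where
    gen-ε    : Generated ε
    gen-step : ∀ {g s} → Generated g → SymGen s → Generated (g ∙ s)

  Generates : Set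
  Generates = ∀ g → Generated g

  Adj : A → A → Set
  Adj g h = S ((g ⁻¹) ∙ h) ⊎ S ((h ⁻¹) ∙ g)

  -- Γ(G,S) is a complete bipartite graph: the vertex set splits into two nonempty
  -- parts (colour classes) and two vertices are adjacent iff they lie in different parts
  CompleteBipartite : Set
  CompleteBipartite =
    Σ (A → Bool) λ c →
        (∀ g h → Adj g h → c g ≢ c h)
      × (∀ g h → c g ≢ c h → Adj g h)
      × (∃ λ g → c g ≡ true)
      × (∃ λ g → c g ≡ false)

  -- a legal move s given the previous move (nothing on the first turn):
  -- s ∈ S ∪ S⁻¹ and s ≠ (previous move)⁻¹
  Legal : Maybe A → A → Set
  Legal nothing  s = SymGen s
  Legal (just p) s = SymGen s × s ≢ p ⁻¹

  -- Game states: current element w (the value of the current word), list of all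
  -- elements visited so far (w_0,…,w_{n-1}, including w), previous move.
  -- Win  w vs p : the player to move has a winning strategy,
  -- Lose w vs p : the opponent of the player to move has a winning strategy.
  -- A proof of Win / Lose is literally a (well-founded) strategy tree.

  -- Game REL(G,S): forming a repeated element wins.
  data RelWin  (w : A) (vs : List A) (p : Maybe A) : Set
  data RelLose (w : A) (vs : List A) (p : Maybe A) : Set

  data RelWin w vs p where
    rel-win : ∀ s → Legal p s →
              ((w ∙ s) ∈ vs ⊎ (¬ (w ∙ s) ∈ vs × RelLose (w ∙ s) ((w ∙ s) ∷ vs) (just s))) →
              RelWin w vs p

  data RelLose w vs p where
    rel-lose : (∀ s → Legal p s →
                 ¬ (w ∙ s) ∈ vs × RelWin (w ∙ s) ((w ∙ s) ∷ vs) (just s)) →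
               RelLose w vs p

  -- Game RAV(G,S): forming a repeated element loses.
  data RavWin  (w : A) (vs : List A) (p : Maybe A) : Set
  data RavLose (w : A) (vs : List A) (p : Maybe A) : Set

  data RavWin w vs p where
    rav-win : ∀ s → Legal p s →
              ¬ (w ∙ s) ∈ vs → RavLose (w ∙ s) ((w ∙ s) ∷ vs) (just s) →
              RavWin w vs p

  data RavLose w vs p where
    rav-lose : (∀ s → Legal p s →
                 (w ∙ s) ∈ vs ⊎ (¬ (w ∙ s) ∈ vs × RavWin (w ∙ s) ((w ∙ s) ∷ vs) (just s))) →
               RavLose w vs p

  -- Player 2 wins REL(G,S): the first player (to move at the empty word) loses.
  Player2WinsREL : Set
  Player2WinsREL = RelLose ε (ε ∷ []) nothing

  Player1WinsRAV : Set
  Player1WinsRAV = RavWin ε (ε ∷ []) nothing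

module Submission where

-- In a complete bipartite Cayley graph every move changes colour, and left multiplication by a
-- vertex of the other colour swaps the two colour classes, so each class has n elements.
-- In RAV, Player 1 always steps to an unvisited vertex of the other colour: this keeps one more
-- unvisited vertex on the far side than on the mover's side, so Player 1 always has a fresh move
-- and Player 2 is eventually forced to revisit. In REL, Player 2 answers the first move by going
-- to a second vertex a ≠ e of e's colour (n ≥ 2); Player 1's next move must reach a new vertex,
-- which lies on the other side, and from there Player 2 closes the cycle by returning to e.

open import Algebra.Bundles using (Group)
open import Algebra.Core using (Op₁; Op₂)
open import Algebra.Structures using (IsGroup)
open import Data.Bool.Base using (Bool; true; false)
open import Data.Bool.Properties using (¬-not) renaming (_≟_ to _≟ᵇ_)
open import Data.Empty using (⊥)
open import Data.Fin.Base using (Fin; zero; suc; punchIn)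
open import Data.Fin.Permutation using (Permutation; permutation; _⟨$⟩ʳ_)
open import Data.Fin.Properties using (punchInᵢ≢i) renaming (_≟_ to _≟ᶠ_)
open import Data.List.Base using (List; []; _∷_)
open import Data.List.Membership.Propositional using (_∈_; _∉_)
open import Data.List.Relation.Unary.Any using (here; there)
open import Data.Maybe.Base using (Maybe; just; nothing)
open import Data.Nat.Base using (ℕ; zero; suc; _+_; _*_; _≤_; s≤s)
open import Data.Nat.Properties using (+-suc; +-identityʳ; suc-injective; *-cancelˡ-≡; +-0-commutativeMonoid)
open import Data.Product.Base using (∃; _×_; _,_; proj₁; map)
open import Data.Sum.Base using (_⊎_; inj₁; inj₂)
open import Data.Vec.Functional using (removeAt)
open import Function.Base using (_∘_; id; case_of_)
open import Function.Bundles using (_⇔_; mk⇔; Equivalence)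
open import Function.Construct.Composition using (_⇔-∘_)
open import Function.Construct.Symmetry using (⇔-sym)
open import Level using (0ℓ)
open import Relation.Binary.PropositionalEquality
open import Relation.Nullary.Decidable using (Dec; yes; no; ¬?; _×-dec_)
open import Relation.Nullary.Negation using (¬_; contradiction)
open import Relation.Unary using (Pred; Decidable; ∁)
open import Relation.Unary.Properties using (∁?)
open import Algebra.Properties.CommutativeMonoid.Sum +-0-commutativeMonoid
  using (sum; sum-cong-≗; sum-remove; sum-permute)

open import Defs

open Equivalence using (to; from)

indicator : {P : Set} → Dec P → ℕ
indicator (yes _) = 1
indicator (no _)  = 0

indicator-yes : {P : Set} → P → (P? : Dec P) → indicator P? ≡ 1
indicator-yes _ (yes _) = refl
indicator-yes p (no ¬p) = contradiction p ¬p

indicator-no : {P : Set} → ¬ P → (P? : Dec P) → indicator P? ≡ 0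
indicator-no ¬p (yes p) = contradiction p ¬p
indicator-no _  (no _)  = refl

indicator-cong : {P Q : Set} → P ⇔ Q → (P? : Dec P) (Q? : Dec Q) → indicator P? ≡ indicator Q?
indicator-cong _   (yes _) (yes _) = refl
indicator-cong P⇔Q (yes p) (no ¬q) = contradiction (to P⇔Q p) ¬q
indicator-cong P⇔Q (no ¬p) (yes q) = contradiction (from P⇔Q q) ¬p
indicator-cong _   (no _)  (no _)  = refl

count : ∀ {m} {P : Pred (Fin m) 0ℓ} → Decidable P → ℕ
count P? = sum (λ i → indicator (P? i))

module _ {m : ℕ} {P Q : Pred (Fin m) 0ℓ} (P? : Decidable P) (Q? : Decidable Q) where

  count-cong : (∀ i → P i ⇔ Q i) → count P? ≡ count Q?
  count-cong P⇔Q = sum-cong-≗ λ i → indicator-cong (P⇔Q i) (P? i) (Q? i)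

  count-permute : (π : Permutation m m) → (∀ i → P (π ⟨$⟩ʳ i) ⇔ Q i) → count P? ≡ count Q?
  count-permute π P∘π⇔Q =
    trans (sum-permute _ π) (sum-cong-≗ λ i → indicator-cong (P∘π⇔Q i) (P? (π ⟨$⟩ʳ i)) (Q? i))

count-remove : ∀ {m} {P Q : Pred (Fin m) 0ℓ} (P? : Decidable P) (Q? : Decidable Q) {g} →
               P g → ¬ Q g → (∀ i → i ≢ g → P i ⇔ Q i) → count P? ≡ suc (count Q?)
count-remove {suc m} P? Q? {g} Pg ¬Qg P⇔Q = begin
  count P?               ≡⟨ sum-remove {i = g} 𝟙P ⟩
  𝟙P g + ∑P-away         ≡⟨ cong₂ _+_ (indicator-yes Pg (P? g)) away-from-g ⟩
  1 + ∑Q-away            ≡⟨ cong (λ x → suc (x + ∑Q-away)) (indicator-no ¬Qg (Q? g)) ⟨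
  suc (𝟙Q g + ∑Q-away)   ≡⟨ cong suc (sum-remove {i = g} 𝟙Q) ⟨
  suc (count Q?)         ∎
  where
  open ≡-Reasoning
  𝟙P 𝟙Q : Fin (suc m) → ℕ
  𝟙P i = indicator (P? i)
  𝟙Q i = indicator (Q? i)
  ∑P-away ∑Q-away : ℕ
  ∑P-away = sum (removeAt 𝟙P g)
  ∑Q-away = sum (removeAt 𝟙Q g)
  away-from-g : ∑P-away ≡ ∑Q-away
  away-from-g = sum-cong-≗ λ j →
    indicator-cong (P⇔Q (punchIn g j) (punchInᵢ≢i g j)) (P? (punchIn g j)) (Q? (punchIn g j))

count≡suc⇒∃ : ∀ {m k} {P : Pred (Fin m) 0ℓ} (P? : Decidable P) → count P? ≡ suc k → ∃ P
count≡suc⇒∃ {suc m} P? eq with P? zero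
... | yes p = zero , p
... | no _  = map suc id (count≡suc⇒∃ (P? ∘ suc) eq)

count-complement : ∀ {m} {P : Pred (Fin m) 0ℓ} (P? : Decidable P) → count P? + count (∁? P?) ≡ m
count-complement {zero}  _  = refl
count-complement {suc m} P? with P? zero
... | yes _ = cong suc (count-complement (P? ∘ suc))
... | no _  = trans (+-suc _ _) (cong suc (count-complement (P? ∘ suc)))

module _ {m : ℕ} where

  open import Data.List.Membership.DecPropositional (_≟ᶠ_ {m}) using (_∈?_)

  Unvisited : Pred (Fin m) 0ℓ → List (Fin m) → Pred (Fin m) 0ℓ
  Unvisited P vs g = P g × g ∉ vs

  unvisited? : {P : Pred (Fin m) 0ℓ} → Decidable P → (vs : List (Fin m)) → Decidable (Unvisited P vs)
  unvisited? P? vs g = P? g ×-dec ¬? (g ∈? vs)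

  #unvisited : {P : Pred (Fin m) 0ℓ} → Decidable P → List (Fin m) → ℕ
  #unvisited P? vs = count (unvisited? P? vs)

  module _ {P : Pred (Fin m) 0ℓ} (P? : Decidable P) where

    #unvisited-[] : #unvisited P? [] ≡ count P?
    #unvisited-[] = count-cong (unvisited? P? []) P? λ _ → mk⇔ proj₁ (_, λ ())

    #unvisited-visit : ∀ {g vs} → P g → g ∉ vs → #unvisited P? vs ≡ suc (#unvisited P? (g ∷ vs))
    #unvisited-visit Pg g∉vs =
      count-remove (unvisited? P? _) (unvisited? P? _) (Pg , g∉vs) (λ (_ , g∉g∷vs) → g∉g∷vs (here refl))
        λ i i≢g → mk⇔
          (λ (Pi , i∉vs) → Pi , λ { (here i≡g) → i≢g i≡g ; (there i∈vs) → i∉vs i∈vs })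
          (λ (Pi , i∉g∷vs) → Pi , i∉g∷vs ∘ there)

    #unvisited-visit-¬ : ∀ {g vs} → ¬ P g → #unvisited P? vs ≡ #unvisited P? (g ∷ vs)
    #unvisited-visit-¬ ¬Pg = count-cong (unvisited? P? _) (unvisited? P? _) λ i →
      mk⇔ (λ (Pi , i∉vs) → Pi , λ { (here refl) → ¬Pg Pi ; (there i∈vs) → i∉vs i∈vs })
          (λ (Pi , i∉g∷vs) → Pi , i∉g∷vs ∘ there)

  #unvisited-cong : {P Q : Pred (Fin m) 0ℓ} (P? : Decidable P) (Q? : Decidable Q) {vs : List (Fin m)} →
                    (∀ g → P g ⇔ Q g) → #unvisited P? vs ≡ #unvisited Q? vs
  #unvisited-cong P? Q? P⇔Q = count-cong (unvisited? P? _) (unvisited? Q? _) λ g →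
    mk⇔ (λ (Pg , g∉) → to (P⇔Q g) Pg , g∉) (λ (Qg , g∉) → from (P⇔Q g) Qg , g∉)

≢⇒≡⇔≢ : {a b x : Bool} → a ≢ b → (a ≡ x) ⇔ (b ≢ x)
≢⇒≡⇔≢ a≢b = mk⇔ (λ a≡x b≡x → a≢b (trans a≡x (sym b≡x)))
                 (λ b≢x → trans (¬-not a≢b) (sym (¬-not (≢-sym b≢x))))

module BipartiteCayley
  {m : ℕ} {mul : Op₂ (Fin m)} {unit : Fin m} {inv : Op₁ (Fin m)} (isGroup : IsGroup _≡_ mul unit inv)
  (S : Pred (Fin m) 0ℓ) (colour : Fin m → Bool)
  (adj⇒≢ : ∀ g h → Cayley.Adj mul unit inv S g h → colour g ≢ colour h)
  (≢⇒adj : ∀ g h → colour g ≢ colour h → Cayley.Adj mul unit inv S g h)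
  where

  group : Group 0ℓ 0ℓ
  group = record { isGroup = isGroup }

  open Group group using (_∙_; ε; _⁻¹; assoc; identityʳ)
  open Cayley _∙_ ε _⁻¹ S
  open import Data.List.Membership.DecPropositional (_≟ᶠ_ {m}) using (_∈?_)
  open import Algebra.Properties.Group group
    using (⁻¹-anti-homo-∙; ⁻¹-involutive; ∙-cancelˡ; \\-leftDividesˡ; \\-leftDividesʳ;
           //-rightDividesˡ; //-rightDividesʳ)
  open ≡-Reasoning

  translate-quotient : ∀ a g h → (a ∙ g) ⁻¹ ∙ (a ∙ h) ≡ g ⁻¹ ∙ h
  translate-quotient a g h = begin
    (a ∙ g) ⁻¹ ∙ (a ∙ h)      ≡⟨ cong (_∙ (a ∙ h)) (⁻¹-anti-homo-∙ a g) ⟩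
    g ⁻¹ ∙ a ⁻¹ ∙ (a ∙ h)     ≡⟨ assoc (g ⁻¹) (a ⁻¹) (a ∙ h) ⟩
    g ⁻¹ ∙ (a ⁻¹ ∙ (a ∙ h))   ≡⟨ cong (g ⁻¹ ∙_) (\\-leftDividesʳ a h) ⟩
    g ⁻¹ ∙ h                  ∎

  adj-translate : ∀ a g h → Adj (a ∙ g) (a ∙ h) ≡ Adj g h
  adj-translate a g h = cong₂ _⊎_ (cong S (translate-quotient a g h)) (cong S (translate-quotient a h g))

  ≢-colour-translate : ∀ a g h → (colour g ≢ colour h) ⇔ (colour (a ∙ g) ≢ colour (a ∙ h))
  ≢-colour-translate a g h = mk⇔
    (λ g≢h → adj⇒≢ _ _ (subst id (sym (adj-translate a g h)) (≢⇒adj g h g≢h)))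
    (λ ag≢ah → adj⇒≢ g h (subst id (adj-translate a g h) (≢⇒adj _ _ ag≢ah)))

  step-recolours : ∀ w {s} → SymGen s → colour w ≢ colour (w ∙ s)
  step-recolours w {s} s-gen = adj⇒≢ w (w ∙ s) (adj-step s-gen)
    where
    adj-step : SymGen s → Adj w (w ∙ s)
    adj-step (inj₁ Ss)   = inj₁ (subst S (sym (\\-leftDividesʳ w s)) Ss)
    adj-step (inj₂ Ss⁻¹) = inj₂ (subst S (sym back) Ss⁻¹)
      where
      back : (w ∙ s) ⁻¹ ∙ w ≡ s ⁻¹
      back = trans (cong (_∙ w) (⁻¹-anti-homo-∙ w s)) (//-rightDividesˡ w (s ⁻¹))

  recoloured⇒symGen : ∀ {w g} → colour w ≢ colour g → SymGen (w ⁻¹ ∙ g)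
  recoloured⇒symGen {w} {g} w≢g with ≢⇒adj w g w≢g
  ... | inj₁ S[w⁻¹g] = inj₁ S[w⁻¹g]
  ... | inj₂ S[g⁻¹w] = inj₂ (subst S (sym inverse) S[g⁻¹w])
    where
    inverse : (w ⁻¹ ∙ g) ⁻¹ ≡ g ⁻¹ ∙ w
    inverse = trans (⁻¹-anti-homo-∙ (w ⁻¹) g) (cong (g ⁻¹ ∙_) (⁻¹-involutive w))

  Behind : Fin m → Maybe (Fin m) → Pred (Fin m) 0ℓ
  Behind w nothing  g = ⊥
  Behind w (just s) g = g ≡ w ∙ s ⁻¹

  behind-step : ∀ w s → Behind (w ∙ s) (just s) w
  behind-step w s = sym (//-rightDividesʳ s w)

  legal-towards : ∀ {w g} p → colour w ≢ colour g → ¬ Behind w p g → Legal p (w ⁻¹ ∙ g)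
  legal-towards nothing w≢g _ = recoloured⇒symGen w≢g
  legal-towards {w} {g} (just s) w≢g g-not-behind = recoloured⇒symGen w≢g , λ s′≡s⁻¹ →
    g-not-behind (trans (sym (\\-leftDividesˡ w g)) (cong (w ∙_) s′≡s⁻¹))

  legal-avoids-behind : ∀ {w g u} p → Legal p u → Behind w p g → w ∙ u ≢ g
  legal-avoids-behind {w} {u = u} (just s) (_ , u≢s⁻¹) g-behind wu≡g =
    u≢s⁻¹ (∙-cancelˡ w u (s ⁻¹) (trans wu≡g g-behind))

  SameColour : Fin m → Pred (Fin m) 0ℓ
  SameColour w g = colour w ≡ colour g

  sameColour? : ∀ w → Decidable (SameColour w)
  sameColour? w g = colour w ≟ᵇ colour g

  otherColour? : ∀ w → Decidable (∁ (SameColour w))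
  otherColour? w = ∁? (sameColour? w)

  translation-swaps-classes : ∀ {b} → colour ε ≢ colour b →
                              ∀ x → SameColour ε (b ∙ x) ⇔ ∁ (SameColour ε) x
  translation-swaps-classes {b} ε≢b x =
    ⇔-sym (subst (λ y → (colour ε ≢ colour x) ⇔ (colour y ≢ colour (b ∙ x))) (identityʳ b)
                 (≢-colour-translate b ε x))
    ⇔-∘ ≢⇒≡⇔≢ ε≢b

  colourClasses-equal : ∀ {b} → colour ε ≢ colour b →
                        count (sameColour? ε) ≡ count (otherColour? ε)
  colourClasses-equal {b} ε≢b = count-permute (sameColour? ε) (otherColour? ε)
    (permutation (b ∙_) (b ⁻¹ ∙_) (\\-leftDividesˡ b) (\\-leftDividesʳ b))
    (translation-swaps-classes ε≢b)

  colourClass-size : ∀ {b} → colour ε ≢ colour b → 2 * count (sameColour? ε) ≡ m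
  colourClass-size {b} ε≢b = begin
    2 * #same                        ≡⟨ cong (#same +_) (+-identityʳ #same) ⟩
    #same + #same                    ≡⟨ cong (#same +_) (colourClasses-equal ε≢b) ⟩
    #same + count (otherColour? ε)   ≡⟨ count-complement (sameColour? ε) ⟩
    m                                ∎
    where
    #same = count (sameColour? ε)

  #unvisited-other-after-move : ∀ {w g vs} → colour w ≢ colour g → g ∉ vs →
    #unvisited (otherColour? w) vs ≡ suc (#unvisited (sameColour? g) (g ∷ vs))
  #unvisited-other-after-move {w} {g} w≢g g∉vs =
    trans (#unvisited-visit (otherColour? w) w≢g g∉vs)
          (cong suc (#unvisited-cong (otherColour? w) (sameColour? g) λ _ →
                       ⇔-sym (≢⇒≡⇔≢ (≢-sym w≢g))))

  #unvisited-same-after-move : ∀ {w g vs} → colour w ≢ colour g →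
    #unvisited (sameColour? w) vs ≡ #unvisited (otherColour? g) (g ∷ vs)
  #unvisited-same-after-move {w} {g} w≢g =
    trans (#unvisited-visit-¬ (sameColour? w) w≢g)
          (#unvisited-cong (sameColour? w) (otherColour? g) λ _ → ≢⇒≡⇔≢ w≢g)

  ravWin-surplus : ∀ k {w vs p} → (∀ {g} → Behind w p g → g ∈ vs) →
    #unvisited (otherColour? w) vs ≡ suc k → #unvisited (sameColour? w) vs ≡ k → RavWin w vs p
  ravLose-balanced : ∀ k {w vs p} → w ∈ vs →
    #unvisited (otherColour? w) vs ≡ k → #unvisited (sameColour? w) vs ≡ k → RavLose w vs (just p)

  ravWin-surplus k {w} {vs} {p} behind∈vs other≡ same≡
    with count≡suc⇒∃ (unvisited? (otherColour? w) vs) other≡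
  ... | g , w≢g , g∉vs =
    rav-win s (legal-towards p w≢g (g∉vs ∘ behind∈vs)) x∉vs
      (ravLose-balanced k (here refl)
        (trans (sym (#unvisited-same-after-move w≢x)) same≡)
        (suc-injective (trans (sym (#unvisited-other-after-move w≢x x∉vs)) other≡)))
    where
    s = w ⁻¹ ∙ g
    reaches : w ∙ s ≡ g
    reaches = \\-leftDividesˡ w g
    w≢x : colour w ≢ colour (w ∙ s)
    w≢x = subst (λ y → colour w ≢ colour y) (sym reaches) w≢g
    x∉vs : w ∙ s ∉ vs
    x∉vs = subst (_∉ vs) (sym reaches) g∉vs

  ravLose-balanced k {w} {vs} w∈vs other≡ same≡ = rav-lose λ s (s-gen , _) → respond s s-gen
    where
    respond : ∀ s → SymGen s →
              w ∙ s ∈ vs ⊎ (w ∙ s ∉ vs × RavWin (w ∙ s) ((w ∙ s) ∷ vs) (just s))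
    respond s s-gen with w ∙ s ∈? vs
    ... | yes revisits = inj₁ revisits
    ... | no  x∉vs     = inj₂ (x∉vs , ravWin-from k
      (trans (sym (#unvisited-other-after-move (step-recolours w s-gen) x∉vs)) other≡)
      (trans (sym (#unvisited-same-after-move (step-recolours w s-gen))) same≡))
      where
      ravWin-from : ∀ k → suc (#unvisited (sameColour? (w ∙ s)) ((w ∙ s) ∷ vs)) ≡ k →
                    #unvisited (otherColour? (w ∙ s)) ((w ∙ s) ∷ vs) ≡ k →
                    RavWin (w ∙ s) ((w ∙ s) ∷ vs) (just s)
      ravWin-from (suc k) same≡ other≡ = ravWin-surplus k behind∈ other≡ (suc-injective same≡)
        where
        behind∈ : ∀ {g} → Behind (w ∙ s) (just s) g → g ∈ (w ∙ s) ∷ vs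
        behind∈ g-behind = there (subst (_∈ vs) (trans (behind-step w s) (sym g-behind)) w∈vs)

  player1WinsRAV : ∀ {b} → colour ε ≢ colour b → Player1WinsRAV
  player1WinsRAV ε≢b = ravWin-surplus _ (λ ()) surplus refl
    where
    surplus : #unvisited (otherColour? ε) (ε ∷ []) ≡ suc (#unvisited (sameColour? ε) (ε ∷ []))
    surplus = begin
      #unvisited (otherColour? ε) (ε ∷ [])       ≡⟨ #unvisited-visit-¬ (otherColour? ε) (λ ε≢ε → ε≢ε refl) ⟨
      #unvisited (otherColour? ε) []             ≡⟨ #unvisited-[] (otherColour? ε) ⟩
      count (otherColour? ε)                     ≡⟨ colourClasses-equal ε≢b ⟨
      count (sameColour? ε)                      ≡⟨ #unvisited-[] (sameColour? ε) ⟨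
      #unvisited (sameColour? ε) []              ≡⟨ #unvisited-visit (sameColour? ε) refl (λ ()) ⟩
      suc (#unvisited (sameColour? ε) (ε ∷ []))  ∎

  relLose-returning : ∀ {a w t} → a ≢ ε → SameColour ε a → Behind a (just t) w →
                      RelLose a (a ∷ w ∷ ε ∷ []) (just t)
  relLose-returning {a} {w} {t} a≢ε ε∼a w-behind = rel-lose λ u legal-u →
    fresh u legal-u , rel-win _ (legal-towards (just u) (recoloured u legal-u) (ε-not-behind u))
                                (inj₁ (there (there (there (here (\\-leftDividesˡ (a ∙ u) ε))))))
    where
    recoloured : ∀ u → Legal (just t) u → colour (a ∙ u) ≢ colour ε
    recoloured u (u-gen , _) au∼ε = step-recolours a u-gen (trans (sym ε∼a) (sym au∼ε))
    fresh : ∀ u → Legal (just t) u → a ∙ u ∉ a ∷ w ∷ ε ∷ []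
    fresh u (u-gen , _) (here au≡a) = step-recolours a u-gen (cong colour (sym au≡a))
    fresh u legal-u (there (here au≡w)) = legal-avoids-behind (just t) legal-u w-behind au≡w
    fresh u legal-u (there (there (here au≡ε))) = recoloured u legal-u (cong colour au≡ε)
    ε-not-behind : ∀ u → ¬ Behind (a ∙ u) (just u) ε
    ε-not-behind u ε-behind = a≢ε (trans (behind-step a u) (sym ε-behind))

  player2WinsREL : ∀ {a} → a ≢ ε → SameColour ε a → Player2WinsREL
  player2WinsREL {a} a≢ε ε∼a = rel-lose λ s s-gen → first-fresh s-gen , second-move s-gen
    where
    first-fresh : ∀ {s} → SymGen s → ε ∙ s ∉ ε ∷ []
    first-fresh s-gen (here εs≡ε) = step-recolours ε s-gen (cong colour (sym εs≡ε))
    second-move : ∀ {s} → SymGen s → RelWin (ε ∙ s) ((ε ∙ s) ∷ ε ∷ []) (just s)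
    second-move {s} s-gen = rel-win t (legal-towards (just s) w₁≢a a-not-behind)
      (inj₂ (fresh , relLose-returning (a≢ε ∘ trans (sym reaches)) (trans ε∼a (cong colour (sym reaches)))
                                        (behind-step w₁ t)))
      where
      w₁ = ε ∙ s
      t = w₁ ⁻¹ ∙ a
      reaches : w₁ ∙ t ≡ a
      reaches = \\-leftDividesˡ w₁ a
      w₁≢a : colour w₁ ≢ colour a
      w₁≢a w₁∼a = step-recolours ε s-gen (trans ε∼a (sym w₁∼a))
      a-not-behind : ¬ Behind w₁ (just s) a
      a-not-behind a-behind = a≢ε (trans a-behind (sym (behind-step ε s)))
      fresh : w₁ ∙ t ∉ w₁ ∷ ε ∷ []
      fresh (here x≡w₁) = w₁≢a (cong colour (trans (sym x≡w₁) reaches))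
      fresh (there (here x≡ε)) = a≢ε (trans (sym reaches) x≡ε)

  ∃-sameColour-≢ε : ∀ {k} → count (sameColour? ε) ≡ suc (suc k) → ∃ λ a → a ≢ ε × SameColour ε a
  ∃-sameColour-≢ε size with count≡suc⇒∃ (unvisited? (sameColour? ε) (ε ∷ []))
                              (suc-injective (trans (sym (#unvisited-visit (sameColour? ε) refl (λ ())))
                                                    (trans (#unvisited-[] (sameColour? ε)) size)))
  ... | a , ε∼a , a∉[ε] = a , a∉[ε] ∘ here , ε∼a

both-values⇒≢ : {A : Set} (c : A → Bool) {t f : A} → c t ≡ true → c f ≡ false →
                ∀ x → ∃ λ g → c x ≢ c g
both-values⇒≢ c {t} {f} t-true f-false x with c x
... | true  = f , λ true≡cf → case (trans true≡cf f-false) of λ ()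
... | false = t , λ false≡ct → case (trans false≡ct t-true) of λ ()

theorem2p5 : (n : ℕ) → 2 ≤ n →
    (_∙_ : Fin (2 * n) → Fin (2 * n) → Fin (2 * n)) (e : Fin (2 * n)) (_⁻¹ : Fin (2 * n) → Fin (2 * n)) →
    IsGroup _≡_ _∙_ e _⁻¹ →
    (S : Fin (2 * n) → Set) → ¬ S e →
    Cayley.Generates _∙_ e _⁻¹ S →
    Cayley.CompleteBipartite _∙_ e _⁻¹ S →
    Cayley.Player2WinsREL _∙_ e _⁻¹ S × Cayley.Player1WinsRAV _∙_ e _⁻¹ S
-- The hypotheses ¬ S e and Generates are unused: both already follow from CompleteBipartite.
theorem2p5 n (s≤s (s≤s _)) _∙_ e _⁻¹ isGroup S _ _ (colour , adj⇒≢ , ≢⇒adj , (_ , t-true) , (_ , f-false)) =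
  let open BipartiteCayley isGroup S colour adj⇒≢ ≢⇒adj
      (_ , e≢b)       = both-values⇒≢ colour t-true f-false e
      (_ , a≢e , e∼a) = ∃-sameColour-≢ε (*-cancelˡ-≡ (count (sameColour? e)) n 2 (colourClass-size e≢b))
  in player2WinsREL a≢e e∼a , player1WinsRAV e≢b
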